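{- There exist connected graphs $G$ and $H$ such that $H\subset G$ ($H$ is a subgraph of $G$) and $\frac{\dim_f(H)}{\dim_f(G)}$ can be arbitrarily large; that is, for every real $M$ there exist connected graphs $H\subset G$ with $\frac{\dim_f(H)}{\dim_f(G)}>M$.
   Context: All graphs are finite, simple, undirected and connected; $d(u,w)$ is the length of a shortest $u$–$w$ path. For distinct vertices $x,y$, $R_v\{x,y\}=\{z\in V(G): d(x,z)\neq d(y,z)\}$. For $g:V(G)\to\mathbb{R}$ and $U\subseteq V(G)$, $g(U)=\sum_{s\in U}g(s)$. A function $g:V(G)\to[0,1]$ is a resolving function of $G$ if $g(R_v\{x,y\})\ge 1$ for every pair of distinct vertices $x,y$; the fractional metric dimension is $\dim_f(G)=\min\{g(V(G)): g \text{ is a resolving function of } G\}$.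
   Formalization: The bound $M$ ranges over ℚ instead of the reals, and resolving functions take values in the rationals in [0,1] rather than the real interval. -}

module Defs where

open import Data.Nat using (ℕ; zero; suc; _≡ᵇ_)
open import Data.Fin using (Fin; _≟_)
open import Data.Bool using (Bool; true; false; _∨_; _∧_; not; if_then_else_)
open import Data.List using (List; allFin; map; foldr)
open import Data.Bool.ListAction using (any)
open import Data.Rational using (ℚ; 0ℚ; 1ℚ; _+_; _≤_)
open import Data.Product using (Σ; _×_; ∃)
open import Relation.Nullary using (¬_)
open import Relation.Nullary.Decidable using (⌊_⌋)
open import Relation.Binary.PropositionalEquality using (_≡_; _≢_)
open import Function.Definitions using (Injective)

record Graph (n : ℕ) : Set where
  field
    adj    : Fin n → Fin n → Bool
    adj-sym    : ∀ x y → adj x y ≡ adj y x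
    adj-irrefl : ∀ x → adj x x ≡ false
open Graph public

reachWithin : ∀ {n} → Graph n → ℕ → Fin n → Fin n → Bool
reachWithin G zero    x y = ⌊ x ≟ y ⌋
reachWithin {n} G (suc k) x y =
  reachWithin G k x y ∨ any (λ z → reachWithin G k x z ∧ adj G z y) (allFin n)

Connected : ∀ {n} → Graph n → Set
Connected G = ∀ x y → ∃ λ k → reachWithin G k x y ≡ true

searchDist : ∀ {n} → Graph n → Fin n → Fin n → ℕ → ℕ → ℕ
searchDist G x y k zero = k
searchDist G x y k (suc f) = if reachWithin G k x y then k else searchDist G x y (suc k) f

-- shortest-path distance d(x,y) (correct for connected graphs, where d(x,y) ≤ n - 1)
dist : ∀ {n} → Graph n → Fin n → Fin n → ℕ
dist {n} G x y = searchDist G x y 0 n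

sumℚ : List ℚ → ℚ
sumℚ = foldr _+_ 0ℚ

weight : ∀ {n} → (Fin n → ℚ) → (Fin n → Bool) → ℚ
weight {n} g U = sumℚ (map (λ z → if U z then g z else 0ℚ) (allFin n))

total : ∀ {n} → (Fin n → ℚ) → ℚ
total g = weight g (λ _ → true)

resolvingSet : ∀ {n} → Graph n → Fin n → Fin n → Fin n → Bool
resolvingSet G x y z = not (dist G x z ≡ᵇ dist G y z)

IsResolvingFunction : ∀ {n} → Graph n → (Fin n → ℚ) → Set
IsResolvingFunction G g =
  (∀ z → 0ℚ ≤ g z × g z ≤ 1ℚ) ×
  (∀ x y → x ≢ y → 1ℚ ≤ weight g (resolvingSet G x y))

IsFracMetDim : ∀ {n} → Graph n → ℚ → Set
IsFracMetDim {n} G q =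
  (Σ (Fin n → ℚ) λ g → IsResolvingFunction G g × total g ≡ q) ×
  (∀ (g : Fin n → ℚ) → IsResolvingFunction G g → q ≤ total g)

-- H is (isomorphic to) a subgraph of G: injective vertex map preserving edges
IsSubgraph : ∀ {m n} → Graph m → Graph n → Set
IsSubgraph {m} {n} H G =
  Σ (Fin m → Fin n) λ f → Injective _≡_ _≡_ f ×
    (∀ x y → adj H x y ≡ true → adj G (f x) (f y) ≡ true)

module Submission where

-- Take r pairs of true twins and m further vertices, all forming one clique except that the i-th
-- further vertex sees the b-th pair exactly when bit b of its code is 1. This graph has diameter
-- two, so a vertex resolves two others as soon as it is adjacent to exactly one of them. Each twin
-- pair is resolved only by its own two vertices, so dim_f ≥ r; conversely, if the codes are
-- distinct and each contains both a 0 and a 1, every pair of vertices is resolved by two twin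
-- vertices, and weight ½ on each twin vertex is resolving, so dim_f = r. With m = 0 this is the
-- complete graph K₂ₖ with dim_f = k; it sits in the clique of 2k coded vertices of a graph whose
-- codes have length about log k, and k / log k is unbounded.

open import Defs
open import Data.Nat as ℕ using (ℕ; zero; suc; z≤n; s≤s; _^_; _%_; _/_)
import Data.Nat.Properties as ℕ
open import Data.Nat.DivMod using (m≡m%n+[m/n]*n; m%n<n; m<n*o⇒m/o<n)
open import Data.Nat.Tactic.RingSolver using (solve-∀)
import Data.Integer as ℤ
import Data.Integer.Properties as ℤ
open import Data.Fin using (Fin; zero; suc; _≟_; toℕ)
import Data.Fin.Properties as Fin
open import Data.Bool using (Bool; true; false; _∨_; _∧_; not; if_then_else_; T)
import Data.Bool.Properties as Bool
open import Data.Bool.ListAction using (any)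
open import Data.List using (tabulate; allFin)
open import Data.List.Properties using (map-tabulate)
open import Data.List.Membership.Propositional using (lose)
open import Data.List.Membership.Propositional.Properties using (∈-allFin)
open import Data.List.Relation.Unary.Any using (satisfied)
open import Data.List.Relation.Unary.Any.Properties using (any⁺; any⁻)
open import Data.Rational using (ℚ; mkℚ; 0ℚ; 1ℚ; ½; _+_; _*_; _≤_; _<_; ↥_; *≤*; nonNegative)
open import Data.Rational.Literals using (fromℤ)
import Data.Rational.Properties as ℚ
import Data.Rational.Unnormalised as ℚᵘ
import Data.Rational.Unnormalised.Properties as ℚᵘ
open import Algebra.Bundles using (Ring)
open import Algebra.Properties.Semiring.Mult (Ring.semiring ℚ.+-*-ring) using (×1-homo-*) renaming (_×_ to _·_)
open import Algebra.Properties.CommutativeMonoid.Sum ℚ.+-0-commutativeMonoid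
  using (sum; sum-cong-≗; sum-replicate-zero; ∑-distrib-+)
open import Data.Product using (Σ; _×_; _,_; proj₁)
open import Data.Empty using (⊥-elim)
open import Function.Bundles using (Equivalence)
open import Function.Definitions using (Injective)
open import Relation.Nullary using (yes; no; contradiction)
open import Relation.Nullary.Decidable using (⌊_⌋; ⌊⌋-map′; decidable-stable; from-yes)
open import Relation.Binary.PropositionalEquality

fromℕ : ℕ → ℚ
fromℕ n = n · 1ℚ

0≤fromℕ : ∀ n → 0ℚ ≤ fromℕ n
0≤fromℕ zero = ℚ.≤-refl
0≤fromℕ (suc n) = ℚ.+-mono-≤ (ℚ.nonNegative⁻¹ 1ℚ) (0≤fromℕ n)

fromℕ-mono-< : ∀ {m n} → m ℕ.< n → fromℕ m < fromℕ n
fromℕ-mono-< {zero} {suc n} _ = ℚ.+-mono-<-≤ (ℚ.positive⁻¹ 1ℚ) (0≤fromℕ n)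
fromℕ-mono-< {suc m} {suc n} (s≤s m<n) = ℚ.+-monoʳ-< 1ℚ (fromℕ-mono-< m<n)

fromℕ-homo-* : ∀ m n → fromℕ (m ℕ.* n) ≡ fromℕ m * fromℕ n
fromℕ-homo-* = ×1-homo-*

fromℕ≡fromℤ : ∀ n → fromℕ n ≡ fromℤ (ℤ.+ n)
fromℕ≡fromℤ zero = refl
fromℕ≡fromℤ (suc n) rewrite fromℕ≡fromℤ n =
  ℚ.toℚᵘ-injective (ℚᵘ.≃-trans (ℚ.toℚᵘ-homo-+ 1ℚ (fromℤ (ℤ.+ n))) (ℚᵘ.*≡* numerators))
  where
  numerators : (ℤ.1ℤ ℤ.* ℤ.1ℤ ℤ.+ ℤ.+ n ℤ.* ℤ.1ℤ) ℤ.* ℤ.1ℤ ≡ ℤ.+ suc n ℤ.* (ℤ.1ℤ ℤ.* ℤ.1ℤ)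
  numerators = trans (ℤ.*-identityʳ _)
                     (trans (cong (ℤ._+_ ℤ.1ℤ) (ℤ.*-identityʳ (ℤ.+ n))) (sym (ℤ.*-identityʳ _)))

≤fromℕ∣↥∣ : ∀ p → p ≤ fromℕ ℤ.∣ ↥ p ∣
≤fromℕ∣↥∣ (mkℚ (ℤ.+ k) _ _) rewrite fromℕ≡fromℤ k =
  *≤* (ℤ.*-monoˡ-≤-nonNeg (ℤ.+ k) (ℤ.+≤+ (s≤s z≤n)))
≤fromℕ∣↥∣ (mkℚ ℤ.-[1+ k ] _ _) rewrite fromℕ≡fromℤ (suc k) = *≤* ℤ.-≤+

*fromℕ<fromℕ : ∀ p m n → ℤ.∣ ↥ p ∣ ℕ.* m ℕ.< n → p * fromℕ m < fromℕ n
*fromℕ<fromℕ p m n N*m<n =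
  ℚ.≤-<-trans p*m≤N*m (subst (_< fromℕ n) (fromℕ-homo-* ℤ.∣ ↥ p ∣ m) (fromℕ-mono-< N*m<n))
  where
  p*m≤N*m : p * fromℕ m ≤ fromℕ ℤ.∣ ↥ p ∣ * fromℕ m
  p*m≤N*m = ℚ.*-monoʳ-≤-nonNeg (fromℕ m) {{nonNegative (0≤fromℕ m)}} (≤fromℕ∣↥∣ p)

restrict : ∀ {n} → (Fin n → ℚ) → (Fin n → Bool) → Fin n → ℚ
restrict g U z = if U z then g z else 0ℚ

sumℚ-tabulate : ∀ {n} (f : Fin n → ℚ) → sumℚ (tabulate f) ≡ sum f
sumℚ-tabulate {zero} f = refl
sumℚ-tabulate {suc n} f = cong (f zero +_) (sumℚ-tabulate (λ z → f (suc z)))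

weight≡sum : ∀ {n} (g : Fin n → ℚ) U → weight g U ≡ sum (restrict g U)
weight≡sum g U = trans (cong sumℚ (map-tabulate (λ z → z) (restrict g U))) (sumℚ-tabulate (restrict g U))

sum-mono-≤ : ∀ {n} {f h : Fin n → ℚ} → (∀ z → f z ≤ h z) → sum f ≤ sum h
sum-mono-≤ {zero} f≤h = ℚ.≤-refl
sum-mono-≤ {suc n} f≤h = ℚ.+-mono-≤ (f≤h zero) (sum-mono-≤ (λ z → f≤h (suc z)))

restrict-mono : ∀ {n} {g : Fin n → ℚ} {U V} → (∀ z → 0ℚ ≤ g z) →
                (∀ z → U z ≡ true → V z ≡ true) → ∀ z → restrict g U z ≤ restrict g V z
restrict-mono {g = g} {U} {V} g≥0 U⊆V z with U z in Uz
... | true rewrite U⊆V z Uz = ℚ.≤-refl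
... | false with V z
...   | true = g≥0 z
...   | false = ℚ.≤-refl

weight-mono : ∀ {n} {g : Fin n → ℚ} {U V} → (∀ z → 0ℚ ≤ g z) →
              (∀ z → U z ≡ true → V z ≡ true) → weight g U ≤ weight g V
weight-mono {g = g} {U} {V} g≥0 U⊆V rewrite weight≡sum g U | weight≡sum g V =
  sum-mono-≤ (restrict-mono g≥0 U⊆V)

singleton : ∀ {n} → Fin n → Fin n → Bool
singleton p z = ⌊ z ≟ p ⌋

pair : ∀ {n} → Fin n → Fin n → Fin n → Bool
pair p q z = singleton p z ∨ singleton q z

sum-restrict-singleton : ∀ {n} (g : Fin n → ℚ) p → sum (restrict g (singleton p)) ≡ g p
sum-restrict-singleton {suc n} g zero =
  trans (cong (g zero +_) (sum-replicate-zero n)) (ℚ.+-identityʳ (g zero))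
sum-restrict-singleton {suc n} g (suc p) = begin
  0ℚ + sum (λ z → restrict g (singleton (suc p)) (suc z))  ≡⟨ ℚ.+-identityˡ _ ⟩
  sum (λ z → restrict g (singleton (suc p)) (suc z))       ≡⟨ sum-cong-≗ drop-suc ⟩
  sum (restrict (λ z → g (suc z)) (singleton p))           ≡⟨ sum-restrict-singleton (λ z → g (suc z)) p ⟩
  g (suc p)                                                ∎
  where
  open ≡-Reasoning
  drop-suc : ∀ z → restrict g (singleton (suc p)) (suc z) ≡ restrict (λ z → g (suc z)) (singleton p) z
  drop-suc z = cong (λ b → if b then g (suc z) else 0ℚ) (⌊⌋-map′ (cong suc) Fin.suc-injective (z ≟ p))

weight-pair : ∀ {n} (g : Fin n → ℚ) {p q} → p ≢ q → weight g (pair p q) ≡ g p + g q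
weight-pair g {p} {q} p≢q = begin
  weight g (pair p q)                                            ≡⟨ weight≡sum g (pair p q) ⟩
  sum (restrict g (pair p q))                                    ≡⟨ sum-cong-≗ split ⟩
  sum (λ z → restrict g (singleton p) z + restrict g (singleton q) z)
    ≡⟨ ∑-distrib-+ (restrict g (singleton p)) (restrict g (singleton q)) ⟩
  sum (restrict g (singleton p)) + sum (restrict g (singleton q))
    ≡⟨ cong₂ _+_ (sum-restrict-singleton g p) (sum-restrict-singleton g q) ⟩
  g p + g q                                                      ∎
  where
  open ≡-Reasoning
  split : ∀ z → restrict g (pair p q) z ≡ restrict g (singleton p) z + restrict g (singleton q) z
  split z with z ≟ p | z ≟ q
  ... | yes refl | yes refl = ⊥-elim (p≢q refl)
  ... | yes _    | no _     = sym (ℚ.+-identityʳ (g z))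
  ... | no _     | yes _    = sym (ℚ.+-identityˡ (g z))
  ... | no _     | no _     = sym (ℚ.+-identityˡ 0ℚ)

sum-nonneg : ∀ {n} {g : Fin n → ℚ} → (∀ z → 0ℚ ≤ g z) → 0ℚ ≤ sum g
sum-nonneg {n} {g} g≥0 = subst (_≤ sum g) (sum-replicate-zero n) (sum-mono-≤ g≥0)

-- Distances

⌊≟⌋-refl : ∀ {n} (x : Fin n) → ⌊ x ≟ x ⌋ ≡ true
⌊≟⌋-refl x with x ≟ x
... | yes _ = refl
... | no x≢x = ⊥-elim (x≢x refl)

⌊≟⌋-≢ : ∀ {n} {x y : Fin n} → x ≢ y → ⌊ x ≟ y ⌋ ≡ false
⌊≟⌋-≢ {x = x} {y} x≢y with x ≟ y
... | yes x≡y = ⊥-elim (x≢y x≡y)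
... | no _ = refl

⌊≟⌋-sym : ∀ {n} (x y : Fin n) → ⌊ x ≟ y ⌋ ≡ ⌊ y ≟ x ⌋
⌊≟⌋-sym x y with x ≟ y
... | yes refl = sym (⌊≟⌋-refl x)
... | no x≢y = sym (⌊≟⌋-≢ (≢-sym x≢y))

private
  T⇒≡true : ∀ {b} → T b → b ≡ true
  T⇒≡true = Equivalence.to Bool.T-≡

  ≡true⇒T : ∀ {b} → b ≡ true → T b
  ≡true⇒T = Equivalence.from Bool.T-≡

any-allFin⁺ : ∀ {n} (p : Fin n → Bool) {x} → p x ≡ true → any p (allFin n) ≡ true
any-allFin⁺ p {x} px = T⇒≡true (any⁺ p (lose (∈-allFin x) (≡true⇒T px)))

any-allFin⁻ : ∀ {n} (p : Fin n → Bool) → (∀ x → p x ≡ false) → any p (allFin n) ≡ false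
any-allFin⁻ {n} p p≡false with any p (allFin n) in eq
... | false = refl
... | true with satisfied (any⁻ p (allFin n) (≡true⇒T eq))
...   | x , px = contradiction (trans (sym (T⇒≡true px)) (p≡false x)) λ ()

module _ {n} (G : Graph n) where

  reachWithin-1 : ∀ x y → reachWithin G 1 x y ≡ ⌊ x ≟ y ⌋ ∨ adj G x y
  reachWithin-1 x y = cong (⌊ x ≟ y ⌋ ∨_) via-x
    where
    via-x : any (λ z → ⌊ x ≟ z ⌋ ∧ adj G z y) (allFin n) ≡ adj G x y
    via-x with adj G x y in xy
    ... | true = any-allFin⁺ (λ z → ⌊ x ≟ z ⌋ ∧ adj G z y) (cong₂ _∧_ (⌊≟⌋-refl x) xy)
    ... | false = any-allFin⁻ _ λ z → step z
      where
      step : ∀ z → ⌊ x ≟ z ⌋ ∧ adj G z y ≡ false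
      step z with x ≟ z
      ... | yes refl = xy
      ... | no _ = refl

  reachWithin-2⁺ : ∀ {x y} z → adj G x z ≡ true → adj G z y ≡ true → reachWithin G 2 x y ≡ true
  reachWithin-2⁺ {x} {y} z xz zy =
    trans (cong (reachWithin G 1 x y ∨_) (any-allFin⁺ (λ w → reachWithin G 1 x w ∧ adj G w y) (cong₂ _∧_ reach-z zy)))
          (Bool.∨-zeroʳ _)
    where
    reach-z : reachWithin G 1 x z ≡ true
    reach-z = trans (reachWithin-1 x z) (trans (cong (⌊ x ≟ z ⌋ ∨_) xz) (Bool.∨-zeroʳ _))

  searchDist-found : ∀ x y {k} f → reachWithin G k x y ≡ true → searchDist G x y k f ≡ k
  searchDist-found x y zero _ = refl
  searchDist-found x y (suc f) found rewrite found = refl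

  searchDist-skip : ∀ x y {k} f → reachWithin G k x y ≡ false →
                    searchDist G x y k (suc f) ≡ searchDist G x y (suc k) f
  searchDist-skip x y f missed rewrite missed = refl

  searchDist-≥ : ∀ x y k f → k ℕ.≤ searchDist G x y k f
  searchDist-≥ x y k zero = ℕ.≤-refl
  searchDist-≥ x y k (suc f) with reachWithin G k x y
  ... | true = ℕ.≤-refl
  ... | false = ℕ.≤-trans (ℕ.n≤1+n k) (searchDist-≥ x y (suc k) f)

dist-refl : ∀ {n} (G : Graph n) x → dist G x x ≡ 0
dist-refl {n} G x = searchDist-found G x x n (⌊≟⌋-refl x)

dist≡0⇒≡ : ∀ {n} (G : Graph n) {x y} → dist G x y ≡ 0 → x ≡ y
dist≡0⇒≡ {suc m} G {x} {y} d≡0 = decidable-stable (x ≟ y) λ x≢y →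
  ℕ.m<n⇒n≢0 (searchDist-≥ G x y 1 m) (trans (sym (searchDist-skip G x y m (⌊≟⌋-≢ x≢y))) d≡0)

dist-adj : ∀ {n} (G : Graph n) {x y} → x ≢ y → adj G x y ≡ true → dist G x y ≡ 1
dist-adj {suc zero} G {zero} {zero} x≢y _ = ⊥-elim (x≢y refl)
dist-adj {suc (suc m)} G {x} {y} x≢y xy =
  trans (searchDist-skip G x y (suc m) (⌊≟⌋-≢ x≢y))
        (searchDist-found G x y (suc m) (trans (reachWithin-1 G x y) (trans (cong (_ ∨_) xy) (Bool.∨-zeroʳ _))))

dist-nonadj : ∀ {n} (G : Graph n) {x y} z → x ≢ y → adj G x y ≡ false →
              adj G x z ≡ true → adj G z y ≡ true → dist G x y ≡ 2
dist-nonadj {suc zero} G {zero} {zero} _ x≢y _ _ _ = ⊥-elim (x≢y refl)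
dist-nonadj {suc (suc m)} G {x} {y} z x≢y xy xz zy =
  trans (searchDist-skip G x y (suc m) (⌊≟⌋-≢ x≢y))
  (trans (searchDist-skip G x y m (trans (reachWithin-1 G x y) (cong₂ _∨_ (⌊≟⌋-≢ x≢y) xy)))
         (searchDist-found G x y m (reachWithin-2⁺ G z xz zy)))

DiameterTwo : ∀ {n} → Graph n → Set
DiameterTwo {n} G = ∀ x y → x ≢ y → adj G x y ≡ false →
  Σ (Fin n) λ z → adj G x z ≡ true × adj G z y ≡ true

module _ {n} {G : Graph n} (diam₂ : DiameterTwo G) where

  dist-diameterTwo : ∀ {x y} → x ≢ y → dist G x y ≡ (if adj G x y then 1 else 2)
  dist-diameterTwo {x} {y} x≢y with adj G x y in xy
  ... | true = dist-adj G x≢y xy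
  ... | false with diam₂ x y x≢y xy
  ...   | z , xz , zy = dist-nonadj G z x≢y xy xz zy

  diameterTwo⇒connected : Connected G
  diameterTwo⇒connected x y with x ≟ y
  ... | yes refl = 0 , ⌊≟⌋-refl x
  ... | no x≢y with adj G x y in xy
  ...   | true = 1 , trans (reachWithin-1 G x y) (trans (cong (_ ∨_) xy) (Bool.∨-zeroʳ _))
  ...   | false with diam₂ x y x≢y xy
  ...     | z , xz , zy = 2 , reachWithin-2⁺ G z xz zy

resolvingSet-≢ : ∀ {n} (G : Graph n) {x y z} → dist G x z ≢ dist G y z → resolvingSet G x y z ≡ true
resolvingSet-≢ G {x} {y} {z} d≢d with dist G x z ℕ.≡ᵇ dist G y z in eq
... | true = contradiction (ℕ.≡ᵇ⇒≡ _ _ (≡true⇒T eq)) d≢d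
... | false = refl

resolvingSet-≡ : ∀ {n} (G : Graph n) {x y z} → dist G x z ≡ dist G y z → resolvingSet G x y z ≡ false
resolvingSet-≡ G {x} {y} {z} d≡d = cong not (T⇒≡true (ℕ.≡⇒≡ᵇ _ _ d≡d))

self-resolves : ∀ {n} (G : Graph n) {x y} → x ≢ y → dist G x x ≢ dist G y x
self-resolves G x≢y d≡d = x≢y (sym (dist≡0⇒≡ G (trans (sym d≡d) (dist-refl G _))))

Twins : ∀ {n} → Graph n → Fin n → Fin n → Set
Twins G x y = ∀ z → z ≢ x → z ≢ y → dist G x z ≡ dist G y z

adjacency-twins : ∀ {n} {G : Graph n} → DiameterTwo G → ∀ {x y} →
                  (∀ z → z ≢ x → z ≢ y → adj G x z ≡ adj G y z) → Twins G x y
adjacency-twins {G = G} diam₂ same z z≢x z≢y =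
  trans (dist-diameterTwo diam₂ (≢-sym z≢x))
        (trans (cong (λ b → if b then 1 else 2) (same z z≢x z≢y))
               (sym (dist-diameterTwo diam₂ (≢-sym z≢y))))

twins-weight : ∀ {n} {G : Graph n} {g x y} → IsResolvingFunction G g → x ≢ y → Twins G x y →
               1ℚ ≤ g x + g y
twins-weight {G = G} {g} {x} {y} (bounds , resolves) x≢y twins =
  ℚ.≤-trans (resolves x y x≢y) (subst (weight g (resolvingSet G x y) ≤_) (weight-pair g x≢y)
    (weight-mono (λ z → proj₁ (bounds z)) R⊆xy))
  where
  R⊆xy : ∀ z → resolvingSet G x y z ≡ true → pair x y z ≡ true
  R⊆xy z z∈R with z ≟ x | z ≟ y
  ... | yes _ | _ = refl
  ... | no _ | yes _ = refl
  ... | no z≢x | no z≢y = contradiction (trans (sym z∈R) (resolvingSet-≡ G (twins z z≢x z≢y))) λ ()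

resolved-by-pair : ∀ {n} (G : Graph n) {g : Fin n → ℚ} {x y p q} → (∀ z → 0ℚ ≤ g z) → p ≢ q →
                   dist G x p ≢ dist G y p → dist G x q ≢ dist G y q →
                   g p + g q ≤ weight g (resolvingSet G x y)
resolved-by-pair G {g} {x} {y} {p} {q} g≥0 p≢q p-resolves q-resolves =
  subst (_≤ weight g (resolvingSet G x y)) (weight-pair g p≢q) (weight-mono g≥0 pq⊆R)
  where
  pq⊆R : ∀ z → pair p q z ≡ true → resolvingSet G x y z ≡ true
  pq⊆R z z∈pq with z ≟ p | z ≟ q
  ... | yes refl | _ = resolvingSet-≢ G p-resolves
  ... | no _ | yes refl = resolvingSet-≢ G q-resolves
  ... | no _ | no _ = contradiction z∈pq λ ()

-- Twin-pair graphs

graphOf : ∀ {n} (R : Fin n → Fin n → Bool) → (∀ x y → R x y ≡ R y x) → Graph n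
graphOf R R-sym = record
  { adj        = λ x y → not ⌊ x ≟ y ⌋ ∧ R x y
  ; adj-sym    = λ x y → cong₂ (λ b c → not b ∧ c) (⌊≟⌋-sym x y) (R-sym x y)
  ; adj-irrefl = λ x → cong (λ b → not b ∧ R x x) (⌊≟⌋-refl x)
  }

adj-graphOf : ∀ {n} (R : Fin n → Fin n → Bool) R-sym {x y} → x ≢ y → adj (graphOf R R-sym) x y ≡ R x y
adj-graphOf R _ {x} {y} x≢y = cong (λ b → not b ∧ R x y) (⌊≟⌋-≢ x≢y)

data Vertex (r m : ℕ) : Set where
  twin  : Fin r → Bool → Vertex r m
  coded : Fin m → Vertex r m

order : ℕ → ℕ → ℕ
order zero    m = m
order (suc r) m = suc (suc (order r m))

shift : ∀ {r m} → Vertex r m → Vertex (suc r) m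
shift (twin b t) = twin (suc b) t
shift (coded i)  = coded i

vertex : ∀ r {m} → Fin (order r m) → Vertex r m
vertex zero    v             = coded v
vertex (suc r) zero          = twin zero true
vertex (suc r) (suc zero)    = twin zero false
vertex (suc r) (suc (suc v)) = shift (vertex r v)

index : ∀ r {m} → Vertex r m → Fin (order r m)
index zero    (coded i)         = i
index (suc r) (twin zero true)  = zero
index (suc r) (twin zero false) = suc zero
index (suc r) (twin (suc b) t)  = suc (suc (index r (twin b t)))
index (suc r) (coded i)         = suc (suc (index r (coded i)))

vertex-index : ∀ r {m} (u : Vertex r m) → vertex r (index r u) ≡ u
vertex-index zero    (coded i)         = refl
vertex-index (suc r) (twin zero true)  = refl
vertex-index (suc r) (twin zero false) = refl
vertex-index (suc r) (twin (suc b) t)  = cong shift (vertex-index r (twin b t))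
vertex-index (suc r) (coded i)         = cong shift (vertex-index r (coded i))

index-shift : ∀ r {m} (u : Vertex r m) → index (suc r) (shift u) ≡ suc (suc (index r u))
index-shift r (twin b t) = refl
index-shift r (coded i)  = refl

index-vertex : ∀ r {m} (v : Fin (order r m)) → index r (vertex r v) ≡ v
index-vertex zero    v             = refl
index-vertex (suc r) zero          = refl
index-vertex (suc r) (suc zero)    = refl
index-vertex (suc r) (suc (suc v)) =
  trans (index-shift r (vertex r v)) (cong (λ w → suc (suc w)) (index-vertex r v))

vertex-injective : ∀ r {m} {v w : Fin (order r m)} → vertex r v ≡ vertex r w → v ≡ w
vertex-injective r {v = v} {w} eq =
  trans (sym (index-vertex r v)) (trans (cong (index r) eq) (index-vertex r w))

index-injective : ∀ r {m} {u u′ : Vertex r m} → index r u ≡ index r u′ → u ≡ u′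
index-injective r {u = u} {u′} eq =
  trans (sym (vertex-index r u)) (trans (cong (vertex r) eq) (vertex-index r u′))

twin-injectiveʳ : ∀ {r m b c t s} → twin {r} {m} b t ≡ twin c s → t ≡ s
twin-injectiveʳ refl = refl

half : ∀ {r m} → Vertex r m → ℚ
half (twin _ _) = ½
half (coded _)  = 0ℚ

half-shift : ∀ {r m} (u : Vertex r m) → half (shift u) ≡ half u
half-shift (twin _ _) = refl
half-shift (coded _)  = refl

sum-half : ∀ r {m} → sum (λ x → half (vertex r {m} x)) ≡ fromℕ r
sum-half zero {m} = sum-replicate-zero m
sum-half (suc r) {m} =
  trans (cong (λ s → ½ + (½ + s)) (trans (sum-cong-≗ (λ v → half-shift (vertex r v))) (sum-half r)))
        (sym (ℚ.+-assoc ½ ½ (fromℕ r)))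

sum-≥-pairs : ∀ r {m} (g : Fin (order r m) → ℚ) → (∀ z → 0ℚ ≤ g z) →
              (∀ b → 1ℚ ≤ g (index r (twin b true)) + g (index r (twin b false))) → fromℕ r ≤ sum g
sum-≥-pairs zero    g g≥0 _     = sum-nonneg g≥0
sum-≥-pairs (suc r) g g≥0 pairs =
  subst (1ℚ + fromℕ r ≤_) (ℚ.+-assoc (g zero) (g (suc zero)) _)
    (ℚ.+-mono-≤ (pairs zero)
                (sum-≥-pairs r (λ z → g (suc (suc z))) (λ z → g≥0 (suc (suc z))) (λ b → pairs (suc b))))

if-1-2-injective : ∀ {a b : Bool} → (if a then 1 else 2) ≡ (if b then 1 else 2) → a ≡ b
if-1-2-injective {true}  {true}  _ = refl
if-1-2-injective {false} {false} _ = refl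

record Coding (r m : ℕ) : Set where
  field
    code           : Fin m → Fin r → Bool
    separating     : ∀ i j → i ≢ j → Σ (Fin r) λ b → code i b ≢ code j b
    somewhereTrue  : ∀ i → Σ (Fin r) λ b → code i b ≡ true
    somewhereFalse : ∀ i → Σ (Fin r) λ b → code i b ≡ false

module TwinGraph {r m : ℕ} (C : Coding r m) where
  open Coding C

  linked : Vertex r m → Vertex r m → Bool
  linked (twin _ _) (twin _ _) = true
  linked (twin b _) (coded i)  = code i b
  linked (coded i)  (twin b _) = code i b
  linked (coded _)  (coded _)  = true

  linked-sym : ∀ u w → linked u w ≡ linked w u
  linked-sym (twin _ _) (twin _ _) = refl
  linked-sym (twin _ _) (coded _)  = refl
  linked-sym (coded _)  (twin _ _) = refl
  linked-sym (coded _)  (coded _)  = refl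

  linkedAt : Fin (order r m) → Fin (order r m) → Bool
  linkedAt x y = linked (vertex r x) (vertex r y)

  graph : Graph (order r m)
  graph = graphOf linkedAt (λ x y → linked-sym (vertex r x) (vertex r y))

  adj-graph : ∀ {x y} → x ≢ y → adj graph x y ≡ linked (vertex r x) (vertex r y)
  adj-graph = adj-graphOf linkedAt (λ x y → linked-sym (vertex r x) (vertex r y))

  module _ {x y : Fin (order r m)} {u w : Vertex r m} (x↦u : vertex r x ≡ u) (y↦w : vertex r y ≡ w) where

    ≢-of-vertex : u ≢ w → x ≢ y
    ≢-of-vertex u≢w refl = u≢w (trans (sym x↦u) y↦w)

    adj-of-vertex : u ≢ w → adj graph x y ≡ linked u w
    adj-of-vertex u≢w = trans (adj-graph (≢-of-vertex u≢w)) (cong₂ linked x↦u y↦w)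

  adj-index : ∀ {u z} → index r u ≢ z → adj graph (index r u) z ≡ linked u (vertex r z)
  adj-index {u} u≢z = trans (adj-graph u≢z) (cong (λ v → linked v _) (vertex-index r u))

  twin-neighbour : ∀ {x y b t i} → vertex r x ≡ twin b t → vertex r y ≡ coded i → code i b ≡ false →
                   Σ (Fin (order r m)) λ z → adj graph x z ≡ true × adj graph z y ≡ true
  twin-neighbour {x} {y} {b} {t} {i} x↦ y↦ ib with somewhereTrue i
  ... | c , ic = z , adj-of-vertex x↦ z↦ b≢c , trans (adj-of-vertex z↦ y↦ λ ()) ic
    where
    z = index r (twin c true)
    z↦ = vertex-index r (twin c true)
    b≢c : twin b t ≢ twin c true
    b≢c refl = contradiction (trans (sym ib) ic) λ ()

  diameterTwo : DiameterTwo graph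
  diameterTwo x y x≢y xy = by-class (vertex r x) (vertex r y) refl refl (trans (sym (adj-graph x≢y)) xy)
    where
    by-class : ∀ u w → vertex r x ≡ u → vertex r y ≡ w → linked u w ≡ false →
               Σ (Fin (order r m)) λ z → adj graph x z ≡ true × adj graph z y ≡ true
    by-class (twin _ _) (twin _ _) _ _ ()
    by-class (coded _) (coded _) _ _ ()
    by-class (twin b t) (coded i) x↦ y↦ ib = twin-neighbour x↦ y↦ ib
    by-class (coded i) (twin b t) x↦ y↦ ib with twin-neighbour y↦ x↦ ib
    ... | z , yz , zx = z , trans (adj-sym graph x z) zx , trans (adj-sym graph z y) yz

  dist-of-vertex : ∀ {x y u w} → vertex r x ≡ u → vertex r y ≡ w → u ≢ w →
                   dist graph x y ≡ (if linked u w then 1 else 2)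
  dist-of-vertex x↦ y↦ u≢w =
    trans (dist-diameterTwo diameterTwo (≢-of-vertex x↦ y↦ u≢w))
          (cong (λ b → if b then 1 else 2) (adj-of-vertex x↦ y↦ u≢w))

  halfOnTwins : Fin (order r m) → ℚ
  halfOnTwins x = half (vertex r x)

  Resolves : Fin (order r m) → Fin (order r m) → Fin (order r m) → Set
  Resolves x y p = dist graph x p ≢ dist graph y p

  TwinResolvers : Fin (order r m) → Fin (order r m) → Set
  TwinResolvers x y = Σ (Fin (order r m)) λ p → Σ (Fin (order r m)) λ q →
    p ≢ q × halfOnTwins p ≡ ½ × halfOnTwins q ≡ ½ × Resolves x y p × Resolves x y q

  swap-resolvers : ∀ {x y} → TwinResolvers x y → TwinResolvers y x
  swap-resolvers (p , q , p≢q , p↦½ , q↦½ , p-res , q-res) =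
    p , q , p≢q , p↦½ , q↦½ , ≢-sym p-res , ≢-sym q-res

  twin-vs-coded : ∀ {x y b t i} → vertex r x ≡ twin b t → vertex r y ≡ coded i → TwinResolvers x y
  twin-vs-coded {x} {y} {b} {t} {i} x↦ y↦ with somewhereFalse i
  ... | c , ic = x , q , ≢-of-vertex x↦ q↦ x≢q , cong half x↦ , cong half q↦ ,
                 self-resolves graph (≢-of-vertex x↦ y↦ λ ()) , q-res
    where
    q = index r (twin c (not t))
    q↦ = vertex-index r (twin c (not t))
    x≢q : twin b t ≢ twin c (not t)
    x≢q eq = Bool.not-¬ refl (twin-injectiveʳ eq)
    q-res : Resolves x y q
    q-res rewrite dist-of-vertex x↦ q↦ x≢q | dist-of-vertex y↦ q↦ (λ ()) | ic = λ ()

  coded-vs-coded : ∀ {x y i j} → vertex r x ≡ coded i → vertex r y ≡ coded j → i ≢ j →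
                   TwinResolvers x y
  coded-vs-coded {x} {y} {i} {j} x↦ y↦ i≢j with separating i j i≢j
  ... | b , ib≢jb =
    p , q , ≢-of-vertex p↦ q↦ (λ ()) , cong half p↦ , cong half q↦ , resolves p↦ , resolves q↦
    where
    p = index r (twin b true)
    q = index r (twin b false)
    p↦ = vertex-index r (twin b true)
    q↦ = vertex-index r (twin b false)
    resolves : ∀ {z t} → vertex r z ≡ twin b t → Resolves x y z
    resolves z↦ d≡d = ib≢jb (if-1-2-injective
      (trans (sym (dist-of-vertex x↦ z↦ λ ())) (trans d≡d (dist-of-vertex y↦ z↦ λ ()))))

  twinResolvers : ∀ x y → x ≢ y → TwinResolvers x y
  twinResolvers x y x≢y = by-class (vertex r x) (vertex r y) refl refl
    where
    by-class : ∀ u w → vertex r x ≡ u → vertex r y ≡ w → TwinResolvers x y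
    by-class (twin _ _) (twin _ _) x↦ y↦ =
      x , y , x≢y , cong half x↦ , cong half y↦ ,
      self-resolves graph x≢y , ≢-sym (self-resolves graph (≢-sym x≢y))
    by-class (twin _ _) (coded _)  x↦ y↦ = twin-vs-coded x↦ y↦
    by-class (coded _)  (twin _ _) x↦ y↦ = swap-resolvers (twin-vs-coded y↦ x↦)
    by-class (coded _)  (coded _)  x↦ y↦ =
      coded-vs-coded x↦ y↦ λ { refl → x≢y (vertex-injective r (trans x↦ (sym y↦))) }

  half-bounds : ∀ (u : Vertex r m) → 0ℚ ≤ half u × half u ≤ 1ℚ
  half-bounds (twin _ _) = from-yes (0ℚ ℚ.≤? ½) , from-yes (½ ℚ.≤? 1ℚ)
  half-bounds (coded _)  = ℚ.≤-refl , from-yes (0ℚ ℚ.≤? 1ℚ)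

  half-resolving : IsResolvingFunction graph halfOnTwins
  half-resolving = (λ z → half-bounds (vertex r z)) , resolving
    where
    resolving : ∀ x y → x ≢ y → 1ℚ ≤ weight halfOnTwins (resolvingSet graph x y)
    resolving x y x≢y with twinResolvers x y x≢y
    ... | p , q , p≢q , p↦½ , q↦½ , p-res , q-res =
      subst (_≤ weight halfOnTwins (resolvingSet graph x y)) (cong₂ _+_ p↦½ q↦½)
        (resolved-by-pair graph (λ z → proj₁ (half-bounds (vertex r z))) p≢q p-res q-res)

  pair-distinct : ∀ b → index r {m} (twin b true) ≢ index r (twin b false)
  pair-distinct b eq with index-injective r eq
  ... | ()

  pair-twins : ∀ b → Twins graph (index r {m} (twin b true)) (index r (twin b false))
  pair-twins b = adjacency-twins diameterTwo λ z z≢p z≢q →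
    trans (adj-index (≢-sym z≢p)) (trans (linked-flip (vertex r z)) (sym (adj-index (≢-sym z≢q))))
    where
    linked-flip : ∀ w → linked (twin b true) w ≡ linked (twin b false) w
    linked-flip (twin _ _) = refl
    linked-flip (coded _)  = refl

  isFracMetDim : IsFracMetDim graph (fromℕ r)
  isFracMetDim = (halfOnTwins , half-resolving , trans (weight≡sum halfOnTwins _) (sum-half r)) , lower-bound
    where
    lower-bound : ∀ g → IsResolvingFunction graph g → fromℕ r ≤ total g
    lower-bound g g-res@(bounds , _) = subst (fromℕ r ≤_) (sym (weight≡sum g (λ _ → true)))
      (sum-≥-pairs r g (λ z → proj₁ (bounds z)) λ b →
        twins-weight g-res (pair-distinct b) (pair-twins b))

  connected : Connected graph
  connected = diameterTwo⇒connected diameterTwo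

  coded-clique : (H : Graph m) → IsSubgraph H graph
  coded-clique H = (λ i → index r (coded i)) , injective , preserves
    where
    injective : Injective _≡_ _≡_ (λ i → index r (coded i))
    injective eq with index-injective r eq
    ... | refl = refl
    preserves : ∀ i j → adj H i j ≡ true → adj graph (index r (coded i)) (index r (coded j)) ≡ true
    preserves i j ij = adj-of-vertex (vertex-index r (coded i)) (vertex-index r (coded j)) i≢j
      where
      i≢j : coded {r} i ≢ coded j
      i≢j refl = contradiction (trans (sym ij) (adj-irrefl H i)) λ ()

-- Binary codes

bit : ℕ → ∀ {s} → Fin s → Bool
bit x zero    = x % 2 ℕ.≡ᵇ 1
bit x (suc b) = bit (x / 2) b

digit-injective : ∀ {a c} → a ℕ.< 2 → c ℕ.< 2 → (a ℕ.≡ᵇ 1) ≡ (c ℕ.≡ᵇ 1) → a ≡ c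
digit-injective {0} {0} _ _ _ = refl
digit-injective {1} {1} _ _ _ = refl
digit-injective {0} {1} _ _ ()
digit-injective {1} {0} _ _ ()
digit-injective {suc (suc _)} (s≤s (s≤s ())) _ _
digit-injective {_} {suc (suc _)} _ (s≤s (s≤s ())) _

bits-injective : ∀ s {x y} → x ℕ.< 2 ^ s → y ℕ.< 2 ^ s → (∀ (b : Fin s) → bit x b ≡ bit y b) →
                 x ≡ y
bits-injective zero    x<1 y<1 _ = trans (ℕ.n<1⇒n≡0 x<1) (sym (ℕ.n<1⇒n≡0 y<1))
bits-injective (suc s) {x} {y} x<2^s y<2^s same = begin
  x                     ≡⟨ m≡m%n+[m/n]*n x 2 ⟩
  x % 2 ℕ.+ x / 2 ℕ.* 2 ≡⟨ cong₂ (λ a c → a ℕ.+ c ℕ.* 2) parity halves ⟩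
  y % 2 ℕ.+ y / 2 ℕ.* 2 ≡⟨ m≡m%n+[m/n]*n y 2 ⟨
  y                     ∎
  where
  open ≡-Reasoning
  halve : ∀ {z} → z ℕ.< 2 ^ suc s → z / 2 ℕ.< 2 ^ s
  halve {z} z< = m<n*o⇒m/o<n (subst (z ℕ.<_) (ℕ.*-comm 2 (2 ^ s)) z<)
  parity : x % 2 ≡ y % 2
  parity = digit-injective (m%n<n x 2) (m%n<n y 2) (same zero)
  halves : x / 2 ≡ y / 2
  halves = bits-injective s (halve x<2^s) (halve y<2^s) (λ b → same (suc b))

-- The two leading coordinates are constant, so every code contains both a 1 and a 0.
binaryCoding : ∀ s {m} → m ℕ.≤ 2 ^ s → Coding (suc (suc s)) m
binaryCoding s {m} m≤2^s = record
  { code           = code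
  ; separating     = separating
  ; somewhereTrue  = λ _ → zero , refl
  ; somewhereFalse = λ _ → suc zero , refl
  }
  where
  code : Fin m → Fin (suc (suc s)) → Bool
  code i zero          = true
  code i (suc zero)    = false
  code i (suc (suc b)) = bit (toℕ i) b

  <2^s : ∀ i → toℕ i ℕ.< 2 ^ s
  <2^s i = ℕ.<-≤-trans (Fin.toℕ<n i) m≤2^s

  separating : ∀ i j → i ≢ j → Σ (Fin (suc (suc s))) λ b → code i b ≢ code j b
  separating i j i≢j with Fin.¬∀⟶∃¬ s (λ b → bit (toℕ i) b ≡ bit (toℕ j) b)
                            (λ b → bit (toℕ i) b Bool.≟ bit (toℕ j) b)
                            (λ same → i≢j (Fin.toℕ-injective (bits-injective s (<2^s i) (<2^s j) same)))
  ... | b , differ = suc (suc b) , differ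

emptyCoding : ∀ k → Coding k 0
emptyCoding k = record { code = λ () ; separating = λ () ; somewhereTrue = λ () ; somewhereFalse = λ () }

order-empty : ∀ k → order k 0 ≡ 2 ℕ.* k
order-empty zero    = refl
order-empty (suc k) = trans (cong (λ n → suc (suc n)) (order-empty k)) (double-suc k)
  where
  double-suc : ∀ k → suc (suc (2 ℕ.* k)) ≡ 2 ℕ.* suc k
  double-suc = solve-∀

n<2^n : ∀ n → n ℕ.< 2 ^ n
n<2^n zero    = s≤s z≤n
n<2^n (suc n) = ℕ.+-mono-≤ (ℕ.m^n>0 2 n) (ℕ.≤-trans (n<2^n n) (ℕ.m≤m+n _ 0))

-- With a = 2N + 2 the square (a + 1)² already exceeds N (2a + 3).
exponent : ℕ → ℕ
exponent N = a ℕ.+ a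
  where
  a = suc (suc (N ℕ.+ N))

linear<exponential : ∀ N → N ℕ.* (3 ℕ.+ exponent N) ℕ.< 2 ^ exponent N
linear<exponential N = begin-strict
  N ℕ.* (3 ℕ.+ (a ℕ.+ a))                     <⟨ ℕ.m<m+n _ (s≤s z≤n) ⟩
  N ℕ.* (3 ℕ.+ (a ℕ.+ a)) ℕ.+ (9 ℕ.+ 5 ℕ.* N)  ≡⟨ square-suc N ⟩
  suc a ℕ.* suc a                             ≤⟨ ℕ.*-mono-≤ (n<2^n a) (n<2^n a) ⟩
  2 ^ a ℕ.* 2 ^ a                             ≡⟨ ℕ.^-distribˡ-+-* 2 a a ⟨
  2 ^ (a ℕ.+ a)                               ∎
  where
  open ℕ.≤-Reasoning
  a = suc (suc (N ℕ.+ N))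
  square-suc : ∀ N → N ℕ.* (3 ℕ.+ (suc (suc (N ℕ.+ N)) ℕ.+ suc (suc (N ℕ.+ N)))) ℕ.+ (9 ℕ.+ 5 ℕ.* N)
                     ≡ suc (suc (suc (N ℕ.+ N))) ℕ.* suc (suc (suc (N ℕ.+ N)))
  square-suc = solve-∀

mainTheorem4 : (M : ℚ) →
    Σ ℕ λ n → Σ ℕ λ m → Σ (Graph n) λ G → Σ (Graph m) λ H →
      Connected G × Connected H × IsSubgraph H G ×
      (Σ ℚ λ qG → Σ ℚ λ qH →
        IsFracMetDim G qG × IsFracMetDim H qH × 0ℚ < qG × M * qG < qH)
mainTheorem4 M =
  order R (order K 0) , order K 0 , Host.graph , Clique.graph ,
  Host.connected , Clique.connected , Host.coded-clique Clique.graph ,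
  fromℕ R , fromℕ K , Host.isFracMetDim , Clique.isFracMetDim ,
  fromℕ-mono-< {0} {R} (s≤s z≤n) , *fromℕ<fromℕ M R K (linear<exponential ℤ.∣ ↥ M ∣)
  where
  s = exponent ℤ.∣ ↥ M ∣
  K = 2 ^ s
  R = 3 ℕ.+ s
  module Clique = TwinGraph (emptyCoding K)
  module Host = TwinGraph (binaryCoding (suc s) (ℕ.≤-reflexive (order-empty K)))
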